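{- Let $m,n$ be integers with $1\le m\le n$, $2\le n\le 2m+1$ and $m\neq n$. Then the metric dimension of the Villarceau grid Type I satisfies $\dim(VG^1_{m,n})>2$.
   Context: For a connected graph $G$ and an ordered set $R=\{r_1,\dots,r_l\}\subseteq V(G)$, the code of a vertex $s$ is $(d(s,r_1),\dots,d(s,r_l))$, where $d$ is the shortest-path distance. $R$ is a resolving set if distinct vertices have distinct codes; $\dim(G)$ is the minimum cardinality of a resolving set. For integers $1\le m\le n$, the Villarceau grid Type I $VG^1_{m,n}$ is the graph with vertex set $\{(2i,2j+1): i\in\{0,\dots,n\},\ j\in\{0,\dots,m-1\}\}\cup\{(2i+1,2j): i\in\{0,\dots,n-1\},\ j\in\{0,\dots,m\}\}$, in which $(i_1,j_1)$ and $(i_2,j_2)$ are adjacent if and only if $|i_1-i_2|=1$ and $|j_1-j_2|=1$. -}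

module Defs where

open import Data.Nat using (ℕ; zero; suc; _+_; _*_; _≤_; _<_)
open import Data.Product using (_×_; ∃; ∃-syntax; _,_)
open import Data.Sum using (_⊎_)
open import Data.List using (List)
open import Data.List.Membership.Propositional using (_∈_)
open import Relation.Binary.PropositionalEquality using (_≡_)

Point : Set
Point = ℕ × ℕ

data InVG (m n : ℕ) : Point → Set where
  even-odd : ∀ i j → i ≤ n → j < m → InVG m n (2 * i , 2 * j + 1)
  odd-even : ∀ i j → i < n → j ≤ m → InVG m n (2 * i + 1 , 2 * j)

Diff1 : ℕ → ℕ → Set
Diff1 a b = (suc a ≡ b) ⊎ (suc b ≡ a)

Adj : Point → Point → Set
Adj (x₁ , y₁) (x₂ , y₂) = Diff1 x₁ x₂ × Diff1 y₁ y₂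

data Walk (m n : ℕ) : Point → Point → ℕ → Set where
  here : ∀ {u} → InVG m n u → Walk m n u u 0
  step : ∀ {u w v k} → InVG m n u → Adj u w → Walk m n w v k → Walk m n u v (suc k)

IsDist : (m n : ℕ) → Point → Point → ℕ → Set
IsDist m n u v k = Walk m n u v k × (∀ k′ → Walk m n u v k′ → k ≤ k′)

SameCode : (m n : ℕ) → List Point → Point → Point → Set
SameCode m n R s t = ∀ r → r ∈ R → ∃[ k ] (IsDist m n s r k × IsDist m n t r k)

Resolving : (m n : ℕ) → List Point → Set
Resolving m n R =
  (∀ r → r ∈ R → InVG m n r) ×
  (∀ s t → InVG m n s → InVG m n t → SameCode m n R s t → s ≡ t)

{-# OPTIONS --safe #-}
module Submission where

-- The vertices of VG¹_{m,n} are the points of [0, 2n] × [0, 2m] with odd coordinate sum, and the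
-- graph distance is the Chebyshev distance. The vertices (x , y) and (x , y + 2) are equidistant from
-- every r with |r_y − (y + 1)| < |r_x − x|, i.e. every r in the open horizontal double cone at their
-- midpoint; symmetrically for (x , y) and (x + 2 , y). In the coordinates x + y and x − y these cones
-- are quadrants, so two landmarks are comparable in the horizontal cone order or strictly in the
-- vertical one, and a midpoint in the cone beyond one of them serves both. This fails only when the
-- landmarks are pressed against the left and right sides, or both lie on one of these sides; as
-- 2n ≥ 2m + 2, explicit pairs can be given for these configurations.

open import Defs
open import Data.Nat using (ℕ; _≤_; _<_; _+_; _*_)
open import Data.List using (List; length)
open import Data.List.Relation.Unary.Unique.Propositional using (Unique)
open import Relation.Binary.PropositionalEquality using (_≢_)

open import Data.Bool using (Bool; true; false; not; _xor_)
open import Data.Bool.Properties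
  using (not-involutive; not-injective; not-¬; not-distribˡ-xor; xor-same; xor-annihilates-not)
open import Data.Empty using (⊥-elim)
open import Data.List using ([]; _∷_)
open import Data.List.Membership.Propositional using (_∈_)
open import Data.List.Relation.Unary.Any using (here; there)
open import Data.Nat using (zero; suc; _⊔_; ∣_-_∣; z≤n; s≤s)
open import Data.Nat.Properties
open import Data.Nat.Tactic.RingSolver using (solve; solve-∀)
open import Data.Product using (_×_; _,_; ∃; proj₁; proj₂)
open import Data.Sum using (_⊎_; inj₁; inj₂)
open import Function using (_∘_)
open import Relation.Binary.Definitions using (tri<; tri≈; tri>)
open import Relation.Binary.PropositionalEquality
open import Relation.Nullary using (¬_; contradiction)

odd : ℕ → Bool
odd zero    = false
odd (suc k) = not (odd k)

Odd : ℕ → Set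
Odd k = odd k ≡ true

Odd-≡ : ∀ {j k} → j ≡ k → Odd j → Odd k
Odd-≡ = subst Odd

Odd-2+ : ∀ k → Odd (2 + k) → Odd k
Odd-2+ k = trans (sym (not-involutive (odd k)))

odd-+ : ∀ j k → odd (j + k) ≡ odd j xor odd k
odd-+ zero    k = refl
odd-+ (suc j) k = trans (cong not (odd-+ j k)) (not-distribˡ-xor (odd j) (odd k))

odd-2* : ∀ k → odd (2 * k) ≡ false
odd-2* k rewrite odd-+ k (k + 0) | +-identityʳ k = xor-same (odd k)

odd-2*+1 : ∀ k → odd (2 * k + 1) ≡ true
odd-2*+1 k rewrite odd-+ (2 * k) 1 | odd-2* k = refl

odd-suc-suc : ∀ a b → odd (suc a + suc b) ≡ odd (a + b)
odd-suc-suc a b rewrite +-suc a b = not-involutive (odd (a + b))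

odd-∣-∣ : ∀ x p → odd ∣ x - p ∣ ≡ odd (x + p)
odd-∣-∣ zero    p       = refl
odd-∣-∣ (suc x) zero    = cong odd (sym (+-identityʳ (suc x)))
odd-∣-∣ (suc x) (suc p) = trans (odd-∣-∣ x p) (sym (odd-suc-suc x p))

odd-flip : ∀ {a a′} → Diff1 a a′ → odd a′ ≡ not (odd a)
odd-flip (inj₁ refl) = refl
odd-flip (inj₂ refl) = sym (not-involutive _)

odd⇒1≤ : ∀ {k} → Odd k → 1 ≤ k
odd⇒1≤ {suc k} _ = s≤s z≤n

parity-gap : ∀ {i j} → odd i ≡ odd j → i < j → 2 + i ≤ j
parity-gap {i} same i<j with m≤n⇒m<n∨m≡n i<j
... | inj₁ 1+i<j = 1+i<j
... | inj₂ refl  = ⊥-elim (not-¬ refl same)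

xor-cross : ∀ x y z w → x xor y ≡ true → z xor w ≡ true → z xor y ≡ x xor w
xor-cross true  true  _     _     () _
xor-cross false false _     _     () _
xor-cross _     _     true  true  _  ()
xor-cross _     _     false false _  ()
xor-cross true  false true  false _  _ = refl
xor-cross true  false false true  _  _ = refl
xor-cross false true  true  false _  _ = refl
xor-cross false true  false true  _  _ = refl

data Parity : ℕ → Set where
  twice   : ∀ k → Parity (2 * k)
  twice+1 : ∀ k → Parity (2 * k + 1)

parity : ∀ x → Parity x
parity zero = twice 0
parity (suc x) with parity x
... | twice k   = subst Parity (+-comm (2 * k) 1) (twice+1 k)
... | twice+1 k = subst Parity (sym (2*+1+1 k)) (twice (suc k))
  where
  2*+1+1 : ∀ k → suc (2 * k + 1) ≡ 2 * suc k
  2*+1+1 = solve-∀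

Vertex : ℕ → ℕ → Point → Set
Vertex W H (x , y) = x ≤ W × y ≤ H × Odd (x + y)

<⇒2*+1≤2* : ∀ {i n} → i < n → 2 * i + 1 ≤ 2 * n
<⇒2*+1≤2* {i} {n} i<n = subst (_≤ 2 * n) (+-comm 1 (2 * i)) (*-monoʳ-< 2 i<n)

2*+1≤2*⇒< : ∀ {i n} → 2 * i + 1 ≤ 2 * n → i < n
2*+1≤2*⇒< {i} {n} le = *-cancelˡ-< 2 i n (subst (_≤ 2 * n) (+-comm (2 * i) 1) le)

InVG⇒Vertex : ∀ {m n p} → InVG m n p → Vertex (2 * n) (2 * m) p
InVG⇒Vertex (even-odd i j i≤n j<m) =
  *-monoʳ-≤ 2 i≤n , <⇒2*+1≤2* j<m ,
  trans (odd-+ (2 * i) (2 * j + 1)) (cong₂ _xor_ (odd-2* i) (odd-2*+1 j))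
InVG⇒Vertex (odd-even i j i<n j≤m) =
  <⇒2*+1≤2* i<n , *-monoʳ-≤ 2 j≤m ,
  trans (odd-+ (2 * i + 1) (2 * j)) (cong₂ _xor_ (odd-2*+1 i) (odd-2* j))

Vertex⇒InVG : ∀ {m n} p → Vertex (2 * n) (2 * m) p → InVG m n p
Vertex⇒InVG (x , y) (x≤ , y≤ , o) with parity x | parity y
... | twice i   | twice+1 j = even-odd i j (*-cancelˡ-≤ 2 x≤) (2*+1≤2*⇒< y≤)
... | twice+1 i | twice j   = odd-even i j (2*+1≤2*⇒< x≤) (*-cancelˡ-≤ 2 y≤)
... | twice i   | twice j   =
  contradiction (trans (sym o) (trans (odd-+ (2 * i) (2 * j)) (cong₂ _xor_ (odd-2* i) (odd-2* j)))) λ ()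
... | twice+1 i | twice+1 j =
  contradiction (trans (sym o) (trans (odd-+ (2 * i + 1) (2 * j + 1)) (cong₂ _xor_ (odd-2*+1 i) (odd-2*+1 j)))) λ ()

-- The graph distance is the Chebyshev distance

cheb : Point → Point → ℕ
cheb (x , y) (p , q) = ∣ x - p ∣ ⊔ ∣ y - q ∣

∣n-1+n∣≡1 : ∀ k → ∣ k - suc k ∣ ≡ 1
∣n-1+n∣≡1 zero    = refl
∣n-1+n∣≡1 (suc k) = ∣n-1+n∣≡1 k

∣-∣-Diff1 : ∀ {x x′} p → Diff1 x x′ → ∣ x - p ∣ ≤ suc ∣ x′ - p ∣
∣-∣-Diff1 {x} {x′} p d = ≤-trans (∣-∣-triangle x x′ p) (≤-reflexive (cong (_+ ∣ x′ - p ∣) (unit d)))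
  where
  unit : ∀ {a b} → Diff1 a b → ∣ a - b ∣ ≡ 1
  unit {a}     (inj₁ refl) = ∣n-1+n∣≡1 a
  unit {b = b} (inj₂ refl) = trans (∣-∣-comm (suc b) b) (∣n-1+n∣≡1 b)

cheb≤length : ∀ {m n u v k} → Walk m n u v k → cheb u v ≤ k
cheb≤length (here {x , y} _) = ≤-reflexive (cong₂ _⊔_ (∣n-n∣≡0 x) (∣n-n∣≡0 y))
cheb≤length {v = p , q} (step _ (dx , dy) w) =
  ⊔-lub (≤-trans (∣-∣-Diff1 p dx) (s≤s (≤-trans (m≤m⊔n _ _) ih)))
        (≤-trans (∣-∣-Diff1 q dy) (s≤s (≤-trans (m≤n⊔m _ _) ih)))
  where ih = cheb≤length w

∣-∣-up : ∀ {x p} → x < p → ∣ suc x - p ∣ ≡ ∣ ∣ x - p ∣ - 1 ∣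
∣-∣-up {zero}  {suc p} _         = sym (∣-∣-identityʳ p)
∣-∣-up {suc x} {suc p} (s≤s x<p) = ∣-∣-up x<p

∣-∣-down : ∀ {x p} → p ≤ x → ∣ x - p ∣ ≡ ∣ ∣ suc x - p ∣ - 1 ∣
∣-∣-down {x}     {zero}  _         = refl
∣-∣-down {suc x} {suc p} (s≤s p≤x) = ∣-∣-down p≤x

approach : ∀ {B} x p → x ≤ B → p ≤ B → 1 ≤ B →
           ∃ λ x′ → Diff1 x x′ × x′ ≤ B × ∣ x′ - p ∣ ≡ ∣ ∣ x - p ∣ - 1 ∣
approach x p x≤B p≤B _ with <-cmp x p
... | tri< x<p _ _ = suc x , inj₁ refl , ≤-trans x<p p≤B , ∣-∣-up x<p
approach (suc x) p x≤B _ _ | tri> _ _ (s≤s p≤x) = x , inj₂ refl , ≤-trans (n≤1+n x) x≤B , ∣-∣-down p≤x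
approach x .x x≤B _ _ | tri≈ _ refl _ with m≤n⇒m<n∨m≡n x≤B
... | inj₁ x<B =
  suc x , inj₁ refl , x<B ,
  trans (trans (∣-∣-comm (suc x) x) (∣n-1+n∣≡1 x)) (cong ∣_- 1 ∣ (sym (∣n-n∣≡0 x)))
approach (suc x) .(suc x) _ _ _ | tri≈ _ refl _ | inj₂ refl =
  x , inj₂ refl , n≤1+n x , trans (∣n-1+n∣≡1 x) (cong ∣_- 1 ∣ (sym (∣n-n∣≡0 x)))

gaps-even : ∀ {x y p q} → Odd (x + y) → Odd (p + q) → odd (∣ x - p ∣ + ∣ y - q ∣) ≡ false
gaps-even {x} {y} {p} {q} o o′ = begin
  odd (∣ x - p ∣ + ∣ y - q ∣)     ≡⟨ odd-+ ∣ x - p ∣ ∣ y - q ∣ ⟩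
  odd ∣ x - p ∣ xor odd ∣ y - q ∣ ≡⟨ cong₂ _xor_ (odd-∣-∣ x p) (odd-∣-∣ y q) ⟩
  odd (x + p) xor odd (y + q)     ≡⟨ sym (odd-+ (x + p) (y + q)) ⟩
  odd (x + p + (y + q))           ≡⟨ cong odd (medial x p y q) ⟩
  odd (x + y + (p + q))           ≡⟨ odd-+ (x + y) (p + q) ⟩
  odd (x + y) xor odd (p + q)     ≡⟨ cong₂ _xor_ o o′ ⟩
  false                           ∎
  where
  open ≡-Reasoning
  medial : ∀ x p y q → x + p + (y + q) ≡ x + y + (p + q)
  medial = solve-∀

odd-Adj : ∀ {x y x′ y′} → Adj (x , y) (x′ , y′) → odd (x′ + y′) ≡ odd (x + y)
odd-Adj {x} {y} {x′} {y′} (dx , dy) = begin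
  odd (x′ + y′)               ≡⟨ odd-+ x′ y′ ⟩
  odd x′ xor odd y′           ≡⟨ cong₂ _xor_ (odd-flip dx) (odd-flip dy) ⟩
  not (odd x) xor not (odd y) ≡⟨ xor-annihilates-not (odd x) (odd y) ⟩
  odd x xor odd y             ≡⟨ sym (odd-+ x y) ⟩
  odd (x + y)                 ∎
  where open ≡-Reasoning

-- If one gap is 0, the other one is even, hence at least 2.
⊔-step : ∀ i j {k} → i ⊔ j ≡ suc k → odd (i + j) ≡ false → ∣ i - 1 ∣ ⊔ ∣ j - 1 ∣ ≡ k
⊔-step zero    (suc j) refl e rewrite ∣-∣-identityʳ j = m≤n⇒m⊔n≡n (odd⇒1≤ (not-injective e))
⊔-step (suc i) zero    refl e rewrite ∣-∣-identityʳ i | +-identityʳ i =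
  m≥n⇒m⊔n≡m (odd⇒1≤ (not-injective e))
⊔-step (suc i) (suc j) e    _ rewrite ∣-∣-identityʳ i | ∣-∣-identityʳ j = suc-injective e

step-closer : ∀ {W H x y p q k} → 1 ≤ W → 1 ≤ H → Vertex W H (x , y) → Vertex W H (p , q) →
              cheb (x , y) (p , q) ≡ suc k → ∃ λ w → Vertex W H w × Adj (x , y) w × cheb w (p , q) ≡ k
step-closer {x = x} {y} {p} {q} 1≤W 1≤H (x≤ , y≤ , o) (p≤ , q≤ , o′) e
  with approach x p x≤ p≤ 1≤W | approach y q y≤ q≤ 1≤H
... | x′ , dx , x′≤ , ex | y′ , dy , y′≤ , ey =
  (x′ , y′) , (x′≤ , y′≤ , trans (odd-Adj (dx , dy)) o) , (dx , dy) ,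
  trans (cong₂ _⊔_ ex ey) (⊔-step ∣ x - p ∣ ∣ y - q ∣ e (gaps-even {x} {y} {p} {q} o o′))

cheb≡0⇒≡ : ∀ {x y p q} → cheb (x , y) (p , q) ≡ 0 → (x , y) ≡ (p , q)
cheb≡0⇒≡ {x} {y} {p} {q} e =
  cong₂ _,_ (∣m-n∣≡0⇒m≡n (n≤0⇒n≡0 (≤-trans (m≤m⊔n ∣ x - p ∣ ∣ y - q ∣) (≤-reflexive e))))
            (∣m-n∣≡0⇒m≡n (n≤0⇒n≡0 (≤-trans (m≤n⊔m ∣ x - p ∣ ∣ y - q ∣) (≤-reflexive e))))

walk-of-length-cheb : ∀ {m n} → 1 ≤ m → 1 ≤ n → ∀ k {u v} →
                      Vertex (2 * n) (2 * m) u → Vertex (2 * n) (2 * m) v → cheb u v ≡ k → Walk m n u v k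
walk-of-length-cheb _ _ zero {x , y} {p , q} Vu _ e with cheb≡0⇒≡ {x} {y} {p} {q} e
... | refl = here (Vertex⇒InVG (x , y) Vu)
walk-of-length-cheb 1≤m 1≤n (suc k) {u} Vu Vv e
  with step-closer (≤-trans 1≤n (m≤m+n _ _)) (≤-trans 1≤m (m≤m+n _ _)) Vu Vv e
... | w , Vw , u~w , e′ = step (Vertex⇒InVG u Vu) u~w (walk-of-length-cheb 1≤m 1≤n k Vw Vv e′)

cheb-isDist : ∀ {m n u v} → 1 ≤ m → 1 ≤ n → Vertex (2 * n) (2 * m) u → Vertex (2 * n) (2 * m) v →
              IsDist m n u v (cheb u v)
cheb-isDist 1≤m 1≤n Vu Vv = walk-of-length-cheb 1≤m 1≤n _ Vu Vv refl , λ _ → cheb≤length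

-- Cones and equidistant pairs

≤-by : ∀ {x y} k → x + k ≡ y → x ≤ y
≤-by {x} k refl = m≤m+n x k

+-suc-suc : ∀ m n → m + suc (suc n) ≡ 2 + m + n
+-suc-suc m n = trans (+-suc m (suc n)) (cong suc (+-suc m n))

infix 4 _≼ₕ_ _≺ₕ_ _≺ᵥ_

-- In the rotated coordinates x + y and x − y, (a , b) ≼ₕ (c , d) and (a , b) ≺ₕ (c , d) are the
-- product order and its strict version: (c , d) lies in the closed, resp. open, cone |dy| ≤ dx
-- opening to the right of (a , b). (a , b) ≺ᵥ (c , d) says that (c , d) lies in the open upward cone
-- |dx| < dy.
data _≼ₕ_ : Point → Point → Set where
  mk≼ₕ : ∀ {a b c d} → a + b ≤ c + d → a + d ≤ c + b → (a , b) ≼ₕ (c , d)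

data _≺ₕ_ : Point → Point → Set where
  mk≺ₕ : ∀ {a b c d} → a + b < c + d → a + d < c + b → (a , b) ≺ₕ (c , d)

data _≺ᵥ_ : Point → Point → Set where
  mk≺ᵥ : ∀ {a b c d} → a + b < c + d → c + b < a + d → (a , b) ≺ᵥ (c , d)

HCone VCone : Point → Point → Set
HCone z r = r ≺ₕ z ⊎ z ≺ₕ r
VCone z r = r ≺ᵥ z ⊎ z ≺ᵥ r

cone-cases : ∀ p q → p ≼ₕ q ⊎ q ≼ₕ p ⊎ p ≺ᵥ q ⊎ q ≺ᵥ p
cone-cases (a , b) (c , d) with ≤-total (a + b) (c + d) | ≤-total (a + d) (c + b)
... | inj₁ u≤ | inj₁ v≤ = inj₁ (mk≼ₕ u≤ v≤)
... | inj₂ u≥ | inj₂ v≥ = inj₂ (inj₁ (mk≼ₕ u≥ v≥))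
... | inj₁ u≤ | inj₂ v≥ with m≤n⇒m<n∨m≡n u≤ | m≤n⇒m<n∨m≡n v≥
...   | inj₁ u< | inj₁ v< = inj₂ (inj₂ (inj₁ (mk≺ᵥ u< v<)))
...   | inj₂ u≡ | _       = inj₂ (inj₁ (mk≼ₕ (≤-reflexive (sym u≡)) v≥))
...   | inj₁ _  | inj₂ v≡ = inj₁ (mk≼ₕ u≤ (≤-reflexive (sym v≡)))
cone-cases (a , b) (c , d) | inj₂ u≥ | inj₁ v≤ with m≤n⇒m<n∨m≡n u≥ | m≤n⇒m<n∨m≡n v≤
...   | inj₁ u< | inj₁ v< = inj₂ (inj₂ (inj₂ (mk≺ᵥ u< v<)))
...   | inj₂ u≡ | _       = inj₁ (mk≼ₕ (≤-reflexive (sym u≡)) v≤)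
...   | inj₁ _  | inj₂ v≡ = inj₂ (inj₁ (mk≼ₕ u≥ (≤-reflexive (sym v≡))))

≼ₕ-≺ₕ-trans : ∀ {p q z} → p ≼ₕ q → q ≺ₕ z → p ≺ₕ z
≼ₕ-≺ₕ-trans (mk≼ₕ {a} {b} {c} {d} u≤ v≤) (mk≺ₕ {c = x} {d = y} u< v<) =
  mk≺ₕ (≤-<-trans u≤ u<)
       (+-cancelˡ-< (c + d) (a + y) (x + b) (subst₂ _<_ (shuffle a d c y) (shuffle′ c b x d) (+-mono-≤-< v≤ v<)))
  where
  shuffle : ∀ a d c y → a + d + (c + y) ≡ c + d + (a + y)
  shuffle = solve-∀
  shuffle′ : ∀ c b x d → c + b + (x + d) ≡ c + d + (x + b)
  shuffle′ = solve-∀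

≺ₕ-≼ₕ-trans : ∀ {z p q} → z ≺ₕ p → p ≼ₕ q → z ≺ₕ q
≺ₕ-≼ₕ-trans (mk≺ₕ {x} {y} {a} {b} u< v<) (mk≼ₕ {c = c} {d = d} u≤ v≤) =
  mk≺ₕ (<-≤-trans u< u≤)
       (+-cancelˡ-< (a + b) (x + d) (c + y) (subst₂ _<_ (shuffle x b a d) (shuffle′ a y c b) (+-mono-<-≤ v< v≤)))
  where
  shuffle : ∀ x b a d → x + b + (a + d) ≡ a + b + (x + d)
  shuffle = solve-∀
  shuffle′ : ∀ a y c b → a + y + (c + b) ≡ a + b + (c + y)
  shuffle′ = solve-∀

≺ₕ-step : ∀ {a b} → (a , b) ≺ₕ (suc a , b)
≺ₕ-step = mk≺ₕ ≤-refl ≤-refl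

≺ₕ-rise : ∀ {a b} → (a , b) ≺ₕ (2 + a , suc b)
≺ₕ-rise {a} {b} = mk≺ₕ (≤-by 2 (solve (a ∷ b ∷ []))) (≤-by 0 (solve (a ∷ b ∷ [])))

≺ₕ-fall : ∀ {a b} → (a , suc b) ≺ₕ (2 + a , b)
≺ₕ-fall {a} {b} = mk≺ₕ (≤-by 0 (solve (a ∷ b ∷ []))) (≤-by 2 (solve (a ∷ b ∷ [])))

≺ᵥ-step : ∀ {a b} → (a , b) ≺ᵥ (a , suc b)
≺ᵥ-step {a} {b} = mk≺ᵥ (+-monoʳ-< a (n<1+n b)) (+-monoʳ-< a (n<1+n b))

≺ᵥ⇒<₂ : ∀ {a b c d} → (a , b) ≺ᵥ (c , d) → b < d
≺ᵥ⇒<₂ {a} {b} {c} {d} (mk≺ᵥ u< v<) = ≰⇒> λ d≤b →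
  <-irrefl refl (<-trans (<-≤-trans u< (+-monoʳ-≤ c d≤b)) (<-≤-trans v< (+-monoʳ-≤ a d≤b)))

-- Both rotated coordinates of two vertices have the same parity.
≺ᵥ-gap : ∀ {a b c d} → Odd (a + b) → Odd (c + d) → (a , b) ≺ᵥ (c , d) →
         2 + (a + b) ≤ c + d × 2 + (c + b) ≤ a + d
≺ᵥ-gap {a} {b} {c} {d} o o′ (mk≺ᵥ u< v<) =
  parity-gap (trans o (sym o′)) u< ,
  parity-gap (begin
    odd (c + b)     ≡⟨ odd-+ c b ⟩
    odd c xor odd b ≡⟨ xor-cross (odd a) (odd b) (odd c) (odd d)
                                 (trans (sym (odd-+ a b)) o) (trans (sym (odd-+ c d)) o′) ⟩
    odd a xor odd d ≡⟨ sym (odd-+ a d) ⟩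
    odd (a + d)     ∎) v<
  where open ≡-Reasoning

≺ᵥ-raise : ∀ {a b c d} → Odd (a + b) → Odd (c + d) → (a , b) ≺ᵥ (c , d) → (a , suc b) ≺ᵥ (c , d)
≺ᵥ-raise {a} {b} {c} {d} o o′ p≺q with ≺ᵥ-gap o o′ p≺q
... | u , v = mk≺ᵥ (subst (λ k → suc k ≤ c + d) (sym (+-suc a b)) u)
                   (subst (λ k → suc k ≤ a + d) (sym (+-suc c b)) v)

≺ᵥ-lower : ∀ {a b c d} → Odd (a + b) → Odd (c + suc d) → (a , b) ≺ᵥ (c , suc d) → (a , b) ≺ᵥ (c , d)
≺ᵥ-lower {a} {b} {c} {d} o o′ p≺q with ≺ᵥ-gap o o′ p≺q
... | u , v = mk≺ᵥ (≤-pred (subst (2 + (a + b) ≤_) (+-suc c d) u))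
                   (≤-pred (subst (2 + (c + b) ≤_) (+-suc a d) v))

∣-∣<-bound : ∀ {b d h} → b < h + d → d < h + b → ∣ b - d ∣ < h
∣-∣<-bound {zero}  {d}     {h} _  d< = subst (d <_) (+-identityʳ h) d<
∣-∣<-bound {suc b} {zero}  {h} b< _  = subst (suc b <_) (+-identityʳ h) b<
∣-∣<-bound {suc b} {suc d} {h} b< d< =
  ∣-∣<-bound (≤-pred (subst (suc (suc b) ≤_) (+-suc h d) b<)) (≤-pred (subst (suc (suc d) ≤_) (+-suc h b) d<))

≺ₕ⇒∣-∣<∣-∣ : ∀ {a b c d} → (a , b) ≺ₕ (c , d) → ∣ b - d ∣ < ∣ a - c ∣
≺ₕ⇒∣-∣<∣-∣ (mk≺ₕ {zero}  {_} {_}     u< v<)             = ∣-∣<-bound u< v<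
≺ₕ⇒∣-∣<∣-∣ (mk≺ₕ {suc a} {_} {suc c} (s≤s u<) (s≤s v<)) = ≺ₕ⇒∣-∣<∣-∣ (mk≺ₕ {a} {c = c} u< v<)
≺ₕ⇒∣-∣<∣-∣ (mk≺ₕ {suc a} {b} {zero} {d} u< v<)         =
  ⊥-elim (<-asym (≤-<-trans (m≤n+m b (suc a)) u<) (≤-<-trans (m≤n+m d (suc a)) v<))

≺ᵥ⇒∣-∣<∣-∣ : ∀ {a b c d} → (a , b) ≺ᵥ (c , d) → ∣ a - c ∣ < ∣ b - d ∣
≺ᵥ⇒∣-∣<∣-∣ (mk≺ᵥ {a} {b} {c} {d} u< v<) =
  ≺ₕ⇒∣-∣<∣-∣ (mk≺ₕ {b} {a} {d} {c} (subst₂ _<_ (+-comm a b) (+-comm c d) u<)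
                                    (subst₂ _<_ (+-comm c b) (+-comm a d) v<))

HCone⇒∣-∣<∣-∣ : ∀ {x y a b} → HCone (x , y) (a , b) → ∣ y - b ∣ < ∣ x - a ∣
HCone⇒∣-∣<∣-∣ {x} {y} {a} {b} (inj₁ r≺z) = subst₂ _<_ (∣-∣-comm b y) (∣-∣-comm a x) (≺ₕ⇒∣-∣<∣-∣ r≺z)
HCone⇒∣-∣<∣-∣                 (inj₂ z≺r) = ≺ₕ⇒∣-∣<∣-∣ z≺r

VCone⇒∣-∣<∣-∣ : ∀ {x y a b} → VCone (x , y) (a , b) → ∣ x - a ∣ < ∣ y - b ∣
VCone⇒∣-∣<∣-∣ {x} {y} {a} {b} (inj₁ r≺z) = subst₂ _<_ (∣-∣-comm a x) (∣-∣-comm b y) (≺ᵥ⇒∣-∣<∣-∣ r≺z)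
VCone⇒∣-∣<∣-∣                 (inj₂ z≺r) = ≺ᵥ⇒∣-∣<∣-∣ z≺r

vpair-equidistant : ∀ {x y r} → HCone (x , suc y) r → cheb (x , y) r ≡ cheb (x , 2 + y) r
vpair-equidistant {r = _ , b} c = trans (m≥n⇒m⊔n≡m below) (sym (m≥n⇒m⊔n≡m above))
  where
  below = ≤-trans (∣-∣-Diff1 b (inj₁ refl)) (HCone⇒∣-∣<∣-∣ c)
  above = ≤-trans (∣-∣-Diff1 b (inj₂ refl)) (HCone⇒∣-∣<∣-∣ c)

hpair-equidistant : ∀ {x y r} → VCone (suc x , y) r → cheb (x , y) r ≡ cheb (2 + x , y) r
hpair-equidistant {r = a , _} c = trans (m≤n⇒m⊔n≡n left) (sym (m≤n⇒m⊔n≡n right))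
  where
  left  = ≤-trans (∣-∣-Diff1 a (inj₁ refl)) (VCone⇒∣-∣<∣-∣ c)
  right = ≤-trans (∣-∣-Diff1 a (inj₂ refl)) (VCone⇒∣-∣<∣-∣ c)

record Twins (W H : ℕ) (p q : Point) : Set where
  constructor twins
  field
    s t      : Point
    s-vertex : Vertex W H s
    t-vertex : Vertex W H t
    s≢t      : s ≢ t
    p-tie    : cheb s p ≡ cheb t p
    q-tie    : cheb s q ≡ cheb t q

Twins-swap : ∀ {W H p q} → Twins W H p q → Twins W H q p
Twins-swap (twins s t Vs Vt s≢t p-tie q-tie) = twins s t Vs Vt s≢t q-tie p-tie

n≢2+n : ∀ n → n ≢ 2 + n
n≢2+n n e = 1+n≰n (≤-trans (n≤1+n (suc n)) (≤-reflexive (sym e)))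

VPair HPair : ℕ → ℕ → Point → Set
VPair W H (x , y) = Vertex W H (x , y) × 2 + y ≤ H
HPair W H (x , y) = Vertex W H (x , y) × 2 + x ≤ W

vcentre hcentre : Point → Point
vcentre (x , y) = x , suc y
hcentre (x , y) = suc x , y

vpair-twins : ∀ {W H s p q} → VPair W H s → HCone (vcentre s) p → HCone (vcentre s) q → Twins W H p q
vpair-twins {s = x , y} ((x≤ , y≤ , o) , 2+y≤) cp cq =
  twins (x , y) (x , 2 + y) (x≤ , y≤ , o) (x≤ , 2+y≤ , Odd-≡ (sym (+-suc-suc x y)) (trans (not-involutive _) o))
        (n≢2+n y ∘ cong proj₂) (vpair-equidistant cp) (vpair-equidistant cq)

hpair-twins : ∀ {W H s p q} → HPair W H s → VCone (hcentre s) p → VCone (hcentre s) q → Twins W H p q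
hpair-twins {s = x , y} ((x≤ , y≤ , o) , 2+x≤) cp cq =
  twins (x , y) (2 + x , y) (x≤ , y≤ , o) (2+x≤ , y≤ , trans (not-involutive (odd (x + y))) o)
        (n≢2+n x ∘ cong proj₁) (hpair-equidistant cp) (hpair-equidistant cq)

-- Twins for any two landmarks

Edge : ℕ → ℕ → Set
Edge B y = y ≡ 0 ⊎ y ≡ B

edge-or-interior : ∀ {y B} → y ≤ B → Edge B y ⊎ (1 ≤ y × y < B)
edge-or-interior {zero}  _   = inj₁ (inj₁ refl)
edge-or-interior {suc y} y≤B with m≤n⇒m<n∨m≡n y≤B
... | inj₁ y<B = inj₂ (s≤s z≤n , y<B)
... | inj₂ y≡B = inj₁ (inj₂ y≡B)

module _ {W H : ℕ} (W-even : odd W ≡ false) (H-even : odd H ≡ false) (2≤H : 2 ≤ H) (2+H≤W : 2 + H ≤ W) where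

  H≤W : H ≤ W
  H≤W = ≤-trans (≤-trans (n≤1+n H) (n≤1+n (suc H))) 2+H≤W

  1≤W : 1 ≤ W
  1≤W = ≤-trans (s≤s z≤n) 2+H≤W

  3≤W : 3 ≤ W
  3≤W = ≤-trans (s≤s 2≤H) (≤-trans (n≤1+n _) 2+H≤W)

  odd<H : ∀ {y} → Odd y → y ≤ H → y < H
  odd<H o y≤H = ≤∧≢⇒< y≤H λ { refl → contradiction (trans (sym o) H-even) λ () }

  odd-W+ : ∀ {d} → Odd (W + d) → Odd d
  odd-W+ {d} = trans (sym (trans (odd-+ W d) (cong (_xor odd d) W-even)))

  odd-3+ : ∀ {h} → 2 + h ≡ H → Odd (3 + h)
  odd-3+ H≡ = cong not (trans (cong odd H≡) H-even)

  -- The midpoint (d − b , b + 1) has both landmarks in its horizontal cone; mirrored on the right side.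
  left-column-twins : ∀ {b d} → Vertex W H (0 , b) → Vertex W H (0 , d) → (0 , b) ≺ᵥ (0 , d) →
                      Twins W H (0 , b) (0 , d)
  left-column-twins {b} (_ , b≤H , o) (_ , d≤H , o′) p≺q
    with m≤n⇒∃[o]m+o≡n (proj₁ (≺ᵥ-gap o o′ p≺q))
  ... | k , refl =
    vpair-twins {s = 2 + k , b}
      ((≤-trans (s≤s (s≤s (m≤n+m k b))) (≤-trans d≤H H≤W) , b≤H , Odd-≡ (cong (2 +_) (+-comm b k)) o′) ,
       ≤-trans (m≤m+n (2 + b) k) d≤H)
      (inj₁ (mk≺ₕ (≤-by (2 + k) (solve (b ∷ k ∷ []))) (≤-by k (solve (b ∷ k ∷ [])))))
      (inj₁ (mk≺ₕ (≤-by 0 (solve (b ∷ k ∷ []))) (≤-by (2 + k + k) (solve (b ∷ k ∷ [])))))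

  right-column-twins : ∀ {b d} → Vertex W H (W , b) → Vertex W H (W , d) → (W , b) ≺ᵥ (W , d) →
                       Twins W H (W , b) (W , d)
  right-column-twins {b} {d} (_ , b≤H , o) (_ , d≤H , o′) p≺q
    with m≤n⇒∃[o]m+o≡n (+-cancelˡ-≤ W (2 + b) d
                          (subst (_≤ W + d) (sym (+-suc-suc W b)) (proj₁ (≺ᵥ-gap o o′ p≺q))))
  ... | k , refl with m≤n⇒∃[o]m+o≡n (≤-trans (s≤s (s≤s (m≤n+m k b))) (≤-trans d≤H H≤W))
  ...   | j , W≡ =
    vpair-twins {s = j , b + k}
      ((≤-by (2 + k) (trans (+-comm j (2 + k)) W≡) , ≤-trans (≤-trans (n≤1+n _) (n≤1+n _)) d≤H ,
        Odd-2+ (j + (b + k)) (Odd-≡ (trans (cong (_+ b) (sym W≡)) (shift k j b)) o)) , d≤H)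
      (inj₂ (subst (λ w → (j , suc (b + k)) ≺ₕ (w , b)) W≡
              (mk≺ₕ (≤-by 0 (solve (j ∷ b ∷ k ∷ []))) (≤-by (2 + k + k) (solve (j ∷ b ∷ k ∷ []))))))
      (inj₂ (subst (λ w → (j , suc (b + k)) ≺ₕ (w , 2 + b + k)) W≡
              (mk≺ₕ (≤-by (2 + k) (solve (j ∷ b ∷ k ∷ []))) (≤-by k (solve (j ∷ b ∷ k ∷ []))))))
    where
    shift : ∀ k j b → 2 + k + j + b ≡ 2 + (j + (b + k))
    shift = solve-∀

  vertical-twins : ∀ {p q} → Vertex W H p → Vertex W H q → p ≺ᵥ q → Twins W H p q
  vertical-twins Vp@(a≤W , _ , _) Vq@(c≤W , _ , _) p≺q with edge-or-interior a≤W | edge-or-interior c≤W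
  vertical-twins {suc a , b} (a≤W , _ , o) (_ , d≤H , o′) p≺q | inj₂ (_ , a<W) | _ =
    hpair-twins {s = a , suc b}
      ((≤-trans (n≤1+n a) a≤W , ≤-trans (≺ᵥ⇒<₂ p≺q) d≤H , Odd-≡ (sym (+-suc a b)) o) , a<W)
      (inj₁ ≺ᵥ-step) (inj₂ (≺ᵥ-raise o o′ p≺q))
  vertical-twins {_} {_ , zero} _ _ p≺q | inj₁ _ | inj₂ _ = ⊥-elim (n≮0 (≺ᵥ⇒<₂ p≺q))
  vertical-twins {_} {suc c , suc d} (_ , _ , o) (c≤W , d≤H , o′) p≺q | inj₁ _ | inj₂ (_ , c<W) =
    hpair-twins {s = c , d}
      ((≤-trans (n≤1+n c) c≤W , ≤-trans (n≤1+n d) d≤H , trans (sym (odd-suc-suc c d)) o′) , c<W)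
      (inj₁ (≺ᵥ-lower o o′ p≺q)) (inj₂ ≺ᵥ-step)
  ... | inj₁ (inj₁ refl) | inj₁ (inj₁ refl) = left-column-twins Vp Vq p≺q
  ... | inj₁ (inj₂ refl) | inj₁ (inj₂ refl) = right-column-twins Vp Vq p≺q
  vertical-twins _ (_ , d≤H , _) (mk≺ᵥ _ v<) | inj₁ (inj₁ refl) | inj₁ (inj₂ refl) =
    ⊥-elim (<⇒≱ v< (≤-trans d≤H (≤-trans H≤W (m≤m+n W _))))
  vertical-twins _ (_ , d≤H , _) (mk≺ᵥ u< _) | inj₁ (inj₂ refl) | inj₁ (inj₁ refl) =
    ⊥-elim (<⇒≱ u< (≤-trans d≤H (≤-trans H≤W (m≤m+n W _))))

  LeftWall RightWall : Point → Set
  LeftWall  (a , b) = a ≡ 0 ⊎ (a ≡ 1 × Edge H b)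
  RightWall (c , d) = c ≡ W ⊎ (suc c ≡ W × Edge H d)

  LeftPair RightPair : Point → Set
  LeftPair  r = ∃ λ s → VPair W H s × vcentre s ≺ₕ r
  RightPair r = ∃ λ s → VPair W H s × r ≺ₕ vcentre s

  right-pair : ∀ {c d} → Vertex W H (c , d) → RightWall (c , d) ⊎ RightPair (c , d)
  right-pair (c≤W , d≤H , _) with m≤n⇒m<n∨m≡n c≤W | edge-or-interior d≤H
  ... | inj₂ c≡W | _ = inj₁ (inj₁ c≡W)
  right-pair {c} {suc d} (_ , d≤H , o) | inj₁ c<W | inj₂ (_ , d<H) =
    inj₂ ((suc c , d) , ((c<W , ≤-trans (n≤1+n d) d≤H , Odd-≡ (+-suc c d) o) , d<H) , ≺ₕ-step)
  ... | inj₁ c<W | inj₁ edge with m≤n⇒m<n∨m≡n c<W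
  ...   | inj₂ 1+c≡W = inj₁ (inj₂ (1+c≡W , edge))
  right-pair {c} {zero} (_ , _ , o) | inj₁ _ | inj₁ _ | inj₁ 2+c≤W =
    inj₂ ((2 + c , 0) , ((2+c≤W , z≤n , trans (not-involutive _) o) , 2≤H) , ≺ₕ-rise)
  right-pair {c} {1} _ | inj₁ _ | inj₁ (inj₂ 1≡H) | inj₁ _ = ⊥-elim (1+n≰n (subst (2 ≤_) (sym 1≡H) 2≤H))
  right-pair {c} {suc (suc d)} (_ , d≤H , o) | inj₁ _ | inj₁ _ | inj₁ 2+c≤W =
    inj₂ ((2 + c , d) ,
          ((2+c≤W , ≤-trans (≤-trans (n≤1+n d) (n≤1+n _)) d≤H , Odd-≡ (+-suc-suc c d) o) , d≤H) , ≺ₕ-fall)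

  left-pair : ∀ {a b} → Vertex W H (a , b) → LeftWall (a , b) ⊎ LeftPair (a , b)
  left-pair {zero} _ = inj₁ (inj₁ refl)
  left-pair {suc a} (_ , b≤H , _) with edge-or-interior b≤H
  left-pair {suc a} {suc b} (a≤W , b≤H , o) | inj₂ (_ , b<H) =
    inj₂ ((a , b) ,
          ((≤-trans (n≤1+n a) a≤W , ≤-trans (n≤1+n b) b≤H , trans (sym (odd-suc-suc a b)) o) , b<H) , ≺ₕ-step)
  left-pair {1} _ | inj₁ edge = inj₁ (inj₂ (refl , edge))
  left-pair {suc (suc a)} {zero} (a≤W , _ , o) | inj₁ _ =
    inj₂ ((a , 0) ,
          ((≤-trans (≤-trans (n≤1+n a) (n≤1+n _)) a≤W , z≤n , Odd-2+ (a + 0) o) , 2≤H) , ≺ₕ-fall)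
  left-pair {suc (suc a)} {1} _ | inj₁ (inj₂ 1≡H) = ⊥-elim (1+n≰n (subst (2 ≤_) (sym 1≡H) 2≤H))
  left-pair {suc (suc a)} {suc (suc b)} (a≤W , b≤H , o) | inj₁ _ =
    inj₂ ((a , b) ,
          ((≤-trans (≤-trans (n≤1+n a) (n≤1+n _)) a≤W , ≤-trans (≤-trans (n≤1+n b) (n≤1+n _)) b≤H ,
            Odd-2+ (a + b) (Odd-≡ (+-suc-suc a b) (Odd-2+ (a + suc (suc b)) o))) , b≤H) , ≺ₕ-rise)

  edge-shape : ∀ {h y} → 2 + h ≡ H → Edge H y → y ≡ 0 ⊎ y ≡ 2 + h
  edge-shape _  (inj₁ y≡0) = inj₁ y≡0
  edge-shape H≡ (inj₂ y≡H) = inj₂ (trans y≡H (sym H≡))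

  last-column⇒H< : ∀ {c} → suc c ≡ W → H < c
  last-column⇒H< 1+c≡W = ≤-pred (subst (2 + H ≤_) (sym 1+c≡W) 2+H≤W)

  last-column-step : ∀ {c k} → suc c ≡ W → Odd k → k ≤ c → c ≡ k ⊎ 2 + k ≤ c
  last-column-step 1+c≡W k-odd k≤c with m≤n⇒m<n∨m≡n k≤c
  ... | inj₁ k<c = inj₂ (parity-gap (trans k-odd (sym (not-injective (trans (cong odd 1+c≡W) W-even)))) k<c)
  ... | inj₂ k≡c = inj₁ (sym k≡c)

  RightWall⇒H<c : ∀ {c d} → RightWall (c , d) → H < c
  RightWall⇒H<c (inj₁ refl)         = ≤-trans (n≤1+n (suc H)) 2+H≤W
  RightWall⇒H<c (inj₂ (1+c≡W , _)) = last-column⇒H< 1+c≡W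

  bottom-corner-twins : ∀ {c} → c ≡ 3 ⊎ 5 ≤ c → Twins W H (1 , 0) (c , 0)
  bottom-corner-twins (inj₁ refl) =
    hpair-twins {s = 1 , 2} ((1≤W , 2≤H , refl) , 3≤W)
      (inj₁ (mk≺ᵥ (≤-by 2 refl) (≤-by 0 refl))) (inj₁ (mk≺ᵥ (≤-by 0 refl) (≤-by 2 refl)))
  bottom-corner-twins {c} (inj₂ 5≤c) =
    vpair-twins {s = 3 , 0} ((3≤W , z≤n , refl) , 2≤H) (inj₁ ≺ₕ-rise)
      (inj₂ (mk≺ₕ (≤-trans 5≤c (m≤m+n c 0)) (≤-trans (≤-trans (n≤1+n 4) 5≤c) (m≤m+n c 1))))

  top-corner-twins : ∀ {c h} → 2 + h ≡ H → suc c ≡ W → c ≡ 3 ⊎ 5 ≤ c →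
                     Twins W H (1 , 2 + h) (c , 2 + h)
  top-corner-twins {h = h} H≡ 1+c≡W (inj₁ refl)
    with n≤0⇒n≡0 (≤-pred (≤-pred (≤-pred (≤-pred
                    (subst₂ _≤_ (cong (2 +_) (sym H≡)) (sym 1+c≡W) 2+H≤W)))))
  ... | refl =
    hpair-twins {s = 1 , 0} ((1≤W , z≤n , refl) , 3≤W)
      (inj₂ (mk≺ᵥ (≤-by 0 refl) (≤-by 2 refl))) (inj₂ (mk≺ᵥ (≤-by 2 refl) (≤-by 0 refl)))
  top-corner-twins {h = h} H≡ _ (inj₂ 5≤c) with m≤n⇒∃[o]m+o≡n 5≤c
  ... | e , refl =
    vpair-twins {s = 3 , h} ((3≤W , ≤-trans (m≤n+m h 2) (≤-reflexive H≡) , odd-3+ H≡) , ≤-reflexive H≡)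
      (inj₁ ≺ₕ-fall) (inj₂ (mk≺ₕ (≤-by (2 + e) (solve (h ∷ e ∷ []))) (≤-by e (solve (h ∷ e ∷ [])))))

  -- When W = H + 2 no axis-parallel pair works: (1 , 2) and (3 , 0) are both at distance 2 from (1 , 0)
  -- and at distance H from (H + 1 , H).
  rising-corner-twins : ∀ {c h} → c ≡ 3 + h ⊎ 5 + h ≤ c → Twins W H (1 , 0) (c , 2 + h)
  rising-corner-twins {h = h} (inj₁ refl) =
    twins (1 , 2) (3 , 0) (1≤W , 2≤H , refl) (3≤W , z≤n , refl) (λ ()) refl (⊔-comm (2 + h) h)
  rising-corner-twins {h = h} (inj₂ 5+h≤c) with m≤n⇒∃[o]m+o≡n 5+h≤c
  ... | e , refl =
    vpair-twins {s = 3 , 0} ((3≤W , z≤n , refl) , 2≤H) (inj₁ ≺ₕ-rise)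
      (inj₂ (mk≺ₕ (≤-by (2 + h + e + h) (solve (h ∷ e ∷ []))) (≤-by e (solve (h ∷ e ∷ [])))))

  falling-corner-twins : ∀ {c h} → 2 + h ≡ H → c ≡ 3 + h ⊎ 5 + h ≤ c → Twins W H (1 , 2 + h) (c , 0)
  falling-corner-twins {h = h} H≡ (inj₁ refl) =
    twins (1 , h) (3 , 2 + h) (1≤W , h≤H , Odd-2+ (1 + h) (odd-3+ H≡))
          (3≤W , ≤-reflexive H≡ , trans (not-involutive _) (odd-3+ H≡)) (λ ())
          (trans (∣n-2+n∣≡2 h) (cong (2 ⊔_) (sym (∣n-n∣≡0 h))))
          (trans (cong ((2 + h) ⊔_) (∣-∣-identityʳ h)) (⊔-comm (2 + h) h))
    where
    h≤H = ≤-trans (m≤n+m h 2) (≤-reflexive H≡)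
    ∣n-2+n∣≡2 : ∀ k → ∣ k - 2 + k ∣ ≡ 2
    ∣n-2+n∣≡2 zero    = refl
    ∣n-2+n∣≡2 (suc k) = ∣n-2+n∣≡2 k
  falling-corner-twins {h = h} H≡ (inj₂ 5+h≤c) with m≤n⇒∃[o]m+o≡n 5+h≤c
  ... | e , refl =
    vpair-twins {s = 3 , h} ((3≤W , ≤-trans (m≤n+m h 2) (≤-reflexive H≡) , odd-3+ H≡) , ≤-reflexive H≡)
      (inj₁ ≺ₕ-fall) (inj₂ (mk≺ₕ (≤-by e (solve (h ∷ e ∷ []))) (≤-by (2 + h + e + h) (solve (h ∷ e ∷ [])))))

  corner-twins : ∀ {b c d} → Edge H b → Edge H d → suc c ≡ W → Twins W H (1 , b) (c , d)
  corner-twins {c = c} eb ed 1+c≡W with m≤n⇒∃[o]m+o≡n 2≤H | last-column⇒H< 1+c≡W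
  ... | h , H≡ | H<c
    with edge-shape H≡ eb | edge-shape H≡ ed
       | last-column-step 1+c≡W refl (≤-trans (s≤s 2≤H) H<c)
       | last-column-step 1+c≡W (odd-3+ H≡) (subst (_< c) (sym H≡) H<c)
  ... | inj₁ refl | inj₁ refl | from-3 | _        = bottom-corner-twins from-3
  ... | inj₂ refl | inj₂ refl | from-3 | _        = top-corner-twins H≡ 1+c≡W from-3
  ... | inj₁ refl | inj₂ refl | _      | from-H+1 = rising-corner-twins from-H+1
  ... | inj₂ refl | inj₁ refl | _      | from-H+1 = falling-corner-twins H≡ from-H+1

  wall-twins : ∀ {p q} → Vertex W H p → Vertex W H q → LeftWall p → RightWall q → Twins W H p q
  wall-twins {_ , zero}  (_ , _ , ())     _ (inj₁ refl) _
  wall-twins {_ , suc b} {c , d} (_ , b≤H , o) (_ , d≤H , _) (inj₁ refl) wq =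
    vpair-twins {s = 1 , b} ((1≤W , ≤-trans (n≤1+n b) b≤H , o) , b<H) (inj₁ ≺ₕ-step) (inj₂ (mk≺ₕ u< v<))
    where
    b<H = odd<H o b≤H
    H<c = RightWall⇒H<c wq
    u< : 2 + suc b ≤ c + d
    u< = ≤-trans (s≤s b<H) (≤-trans H<c (m≤m+n c d))
    v< : 2 + d ≤ c + suc b
    v< = ≤-trans (s≤s (≤-trans (s≤s d≤H) H<c)) (subst (suc c ≤_) (sym (+-suc c b)) (s≤s (m≤m+n c b)))
  wall-twins {_} {_ , zero} _ (_ , _ , o′) (inj₂ _) (inj₁ refl) = contradiction (odd-W+ o′) λ ()
  wall-twins {_ , b} {_ , suc d} (_ , b≤H , _) (_ , d≤H , o′) (inj₂ (refl , _)) (inj₁ refl)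
    with m≤n⇒∃[o]m+o≡n 1≤W
  ... | w , W≡ =
    vpair-twins {s = w , d}
      ((≤-by 1 (trans (+-comm w 1) W≡) , ≤-trans (n≤1+n d) d≤H ,
        trans (sym (odd-suc-suc w d)) (Odd-≡ (cong (_+ suc d) (sym W≡)) o′)) , d<H)
      (inj₁ (mk≺ₕ u< v<)) (inj₂ (subst (λ x → (w , suc d) ≺ₕ (x , suc d)) W≡ ≺ₕ-step))
    where
    d<H = odd<H (odd-W+ o′) d≤H
    H<w = last-column⇒H< W≡
    u< : 2 + b ≤ w + suc d
    u< = ≤-trans (s≤s (≤-trans (s≤s b≤H) H<w)) (subst (suc w ≤_) (sym (+-suc w d)) (s≤s (m≤m+n w d)))
    v< : 3 + d ≤ w + b
    v< = ≤-trans (s≤s d<H) (≤-trans H<w (m≤m+n w b))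
  wall-twins _ _ (inj₂ (refl , eb)) (inj₂ (1+c≡W , ed)) = corner-twins eb ed 1+c≡W

  horizontal-twins : ∀ {p q} → Vertex W H p → Vertex W H q → p ≼ₕ q → Twins W H p q
  horizontal-twins Vp Vq p≼q with right-pair Vq | left-pair Vp
  ... | inj₂ (_ , pair , q≺z) | _ = vpair-twins pair (inj₁ (≼ₕ-≺ₕ-trans p≼q q≺z)) (inj₁ q≺z)
  ... | inj₁ _ | inj₂ (_ , pair , z≺p) = vpair-twins pair (inj₂ z≺p) (inj₂ (≺ₕ-≼ₕ-trans z≺p p≼q))
  ... | inj₁ wq | inj₁ wp = wall-twins Vp Vq wp wq

  twins-of : ∀ {p q} → Vertex W H p → Vertex W H q → Twins W H p q
  twins-of Vp Vq with cone-cases _ _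
  ... | inj₁ p≼q               = horizontal-twins Vp Vq p≼q
  ... | inj₂ (inj₁ q≼p)        = Twins-swap (horizontal-twins Vq Vp q≼p)
  ... | inj₂ (inj₂ (inj₁ p≺q)) = vertical-twins Vp Vq p≺q
  ... | inj₂ (inj₂ (inj₂ q≺p)) = Twins-swap (vertical-twins Vq Vp q≺p)

pair-not-resolving : ∀ {m n p q} → 1 ≤ m → m < n → Vertex (2 * n) (2 * m) p → Vertex (2 * n) (2 * m) q →
                     ∀ R → (∀ r → r ∈ R → r ≡ p ⊎ r ≡ q) → ¬ Resolving m n R
pair-not-resolving {m} {n} 1≤m m<n Vp Vq R covered (_ , resolves)
  with twins-of (odd-2* n) (odd-2* m) (*-monoʳ-≤ 2 1≤m) 2+2m≤2n Vp Vq
  where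
  2+2m≤2n : 2 + 2 * m ≤ 2 * n
  2+2m≤2n = subst (_≤ 2 * n) (*-distribˡ-+ 2 1 m) (*-monoʳ-≤ 2 m<n)
... | twins s t Vs Vt s≢t p-tie q-tie = s≢t (resolves s t (Vertex⇒InVG s Vs) (Vertex⇒InVG t Vt) same-code)
  where
  dist : ∀ {u v} → Vertex (2 * n) (2 * m) u → Vertex (2 * n) (2 * m) v → IsDist m n u v (cheb u v)
  dist = cheb-isDist 1≤m (≤-trans 1≤m (<⇒≤ m<n))
  same-code : SameCode m n R s t
  same-code r r∈R with covered r r∈R
  ... | inj₁ refl = cheb s r , dist Vs Vp , subst (IsDist m n t r) (sym p-tie) (dist Vt Vp)
  ... | inj₂ refl = cheb s r , dist Vs Vq , subst (IsDist m n t r) (sym q-tie) (dist Vt Vq)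

at-most-two-not-resolving : ∀ {m n} → 1 ≤ m → m < n → ∀ R → length R ≤ 2 → ¬ Resolving m n R
at-most-two-not-resolving {m} {n} 1≤m m<n [] _ = pair-not-resolving 1≤m m<n V01 V01 [] λ _ ()
  where
  V01 : Vertex (2 * n) (2 * m) (0 , 1)
  V01 = z≤n , ≤-trans (n≤1+n 1) (*-monoʳ-≤ 2 1≤m) , refl
at-most-two-not-resolving 1≤m m<n (r ∷ []) _ res@(landmark , _) =
  pair-not-resolving 1≤m m<n Vr Vr _ (λ { _ (here r≡) → inj₁ r≡ }) res
  where Vr = InVG⇒Vertex (landmark r (here refl))
at-most-two-not-resolving 1≤m m<n (r₁ ∷ r₂ ∷ []) _ res@(landmark , _) =
  pair-not-resolving 1≤m m<n (InVG⇒Vertex (landmark r₁ (here refl))) (InVG⇒Vertex (landmark r₂ (there (here refl))))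
    _ (λ { _ (here r≡) → inj₁ r≡ ; _ (there (here r≡)) → inj₂ r≡ }) res
at-most-two-not-resolving _ _ (_ ∷ _ ∷ _ ∷ _) (s≤s (s≤s ()))

lemma1 : (m n : ℕ) → 1 ≤ m → m ≤ n → 2 ≤ n → n ≤ 2 * m + 1 → m ≢ n →
         (R : List Point) → Unique R → Resolving m n R → 2 < length R
lemma1 m n 1≤m m≤n _ _ m≢n R _ res =
  ≰⇒> λ |R|≤2 → at-most-two-not-resolving 1≤m (≤∧≢⇒< m≤n m≢n) R |R|≤2 res
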